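{- For every integer $k \geq 1$ there is a $k$-Abelian periodic infinite word $w$ (over a finite alphabet) such that $\mathcal P^{(k+1)}_w(n) = \Theta(n)$ as $n \to \infty$.
   Context: For a finite word $u$ and a nonempty word $x$, $|u|_x$ denotes the number of occurrences of $x$ as a factor of $u$. Two finite words $u, v$ are $k$-Abelian equivalent ($u \sim_k v$) if $|u|_x = |v|_x$ for all nonempty words $x$ of length at most $k$. For an infinite word $w$, $\mathcal P^{(k)}_w(n)$ is the number of $k$-Abelian equivalence classes among the factors of $w$ of length $n$. An infinite word $w$ is $k$-Abelian periodic if $w = u_1 u_2 u_3 \cdots$ for nonempty finite words $u_1, u_2, \dots$ with $u_i \sim_k u_j$ for all $i, j$. -}

module Defs where

open import Data.Nat using (ℕ; zero; suc; _+_; _*_; _≤_; _<_)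
open import Data.Fin using (Fin)
open import Data.Fin.Properties using (_≟_)
open import Data.List using (List; []; _∷_; length; map; upTo)
open import Data.Bool using (Bool; true; false; _∧_; if_then_else_)
open import Data.Product using (Σ; _×_; ∃)
open import Data.Vec.Functional using (Vector)
open import Relation.Nullary using (¬_; does)
open import Relation.Binary.PropositionalEquality using (_≡_; _≢_)

Word : ℕ → Set
Word m = List (Fin m)

InfWord : ℕ → Set
InfWord m = ℕ → Fin m

isPrefix : ∀ {m} → Word m → Word m → Bool
isPrefix [] _ = true
isPrefix (_ ∷ _) [] = false
isPrefix (a ∷ x) (b ∷ u) = does (a ≟ b) ∧ isPrefix x u

occ : ∀ {m} → Word m → Word m → ℕ
occ x [] = if isPrefix x [] then 1 else 0
occ x (a ∷ u) = (if isPrefix x (a ∷ u) then 1 else 0) + occ x u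

_∼[_]_ : ∀ {m} → Word m → ℕ → Word m → Set
_∼[_]_ {m} u k v = (x : Word m) → 1 ≤ length x → length x ≤ k → occ x u ≡ occ x v

factor : ∀ {m} → InfWord m → ℕ → ℕ → Word m
factor w i n = map (λ j → w (i + j)) (upTo n)

-- w is k-Abelian periodic: w = u₀ u₁ u₂ ⋯ with all uᵢ nonempty and pairwise
-- k-Abelian equivalent.  The factorisation is given by cut points
-- p 0 = 0 < p 1 < p 2 < ⋯, with uᵢ = w[p i .. p (i+1) - 1].
KAbelianPeriodic : ∀ {m} → ℕ → InfWord m → Set
KAbelianPeriodic {m} k w =
  Σ (ℕ → ℕ) λ p →
    (p 0 ≡ 0) ×
    ((i : ℕ) → p i < p (suc i)) ×
    ((i j : ℕ) →
      (factor w (p i) (lengthOf p i)) ∼[ k ] (factor w (p j) (lengthOf p j)))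
  where
    open import Data.Nat using (_∸_)
    lengthOf : (ℕ → ℕ) → ℕ → ℕ
    lengthOf p i = p (suc i) ∸ p i

-- P^{(k)}_w(n) = c : there are c factors of length n (given by their start
-- positions) that are pairwise not k-Abelian equivalent, and every factor of
-- length n is k-Abelian equivalent to one of them.
ClassCount : ∀ {m} → ℕ → InfWord m → ℕ → ℕ → Set
ClassCount k w n c =
  Σ (Vector ℕ c) λ pos →
    ((a b : Fin c) → a ≢ b → ¬ (factor w (pos a) n ∼[ k ] factor w (pos b) n)) ×
    ((i : ℕ) → Σ (Fin c) λ a → factor w i n ∼[ k ] factor w (pos a) n)

ThetaLinear : ∀ {m} → ℕ → InfWord m → Set
ThetaLinear k w =
  Σ ℕ λ a → Σ ℕ λ b → Σ ℕ λ N →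
    (n : ℕ) → N ≤ n →
      Σ ℕ λ c → ClassCount k w n c × (n ≤ a * c) × (c ≤ b * n)

-- Concatenate the blocks 0 0^(k−1) 1 0^(k−1) 2 0^(k−1) and 0 0^(k−1) 2 0^(k−1) 1 0^(k−1), of length
-- L = 3k, choosing the i-th one by a Boolean sequence τ whose runs have doubling lengths. A factor
-- of length at most k cannot reach from one separating letter to the other, so swapping them
-- preserves all counts of such factors: the word is k-Abelian periodic. The factor 1 0^(k−1) 2 of
-- length k + 1 counts the blocks of the first kind. For m = ⌊n/L⌋ the runs of τ around 2^(2m+1)
-- give m + 1 factors of length n with m + 1 different counts, so there are at least n/L classes.
-- Conversely, a late window of ℓ values of τ has at most one switch and therefore already occurs
-- starting before 8(ℓ + 1); so every factor of length n equals one starting before 8(n/L + 3)L,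
-- and there are O(n) classes.

module Submission where

open import Defs
open import Data.Nat using (ℕ; zero; suc; _+_; _*_; _∸_; _^_; _⊓_; _≤_; _<_; z≤n; s≤s; _<?_; _/_; _%_)
open import Data.Nat.Properties
open import Data.Nat.DivMod
open import Algebra.Properties.CommutativeSemigroup +-commutativeSemigroup using (xy∙z≈xz∙y)
open import Data.Nat.Divisibility using (divides)
open import Data.Fin as Fin using (Fin; toℕ)
open import Data.Fin.Properties using (all?; any?; toℕ-injective; injective⇒≤; toℕ≤pred[n])
open import Data.List using ([]; _∷_; [_]; length; applyUpTo; _++_; replicate; take; drop)
open import Data.List.Properties using (++-assoc; length-++; length-replicate; map-applyUpTo; take-all)
open import Data.Bool using (Bool; true; false; not; if_then_else_; _∧_)
open import Data.Bool.Properties using (not-involutive; ¬-not) renaming (_≟_ to _≟ᵇ_)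
open import Data.Product using (Σ; _×_; _,_; proj₁; proj₂)
open import Data.Sum using (inj₁; inj₂)
open import Function using (_∘_)
open import Relation.Nullary using (¬_; Dec; yes; no; does; map′; _×-dec_; _→-dec_)
open import Relation.Nullary.Negation using (contradiction)
open import Relation.Binary.Definitions using (tri<; tri≈; tri>)
open import Data.Nat.Tactic.RingSolver using (solve-∀)
open import Relation.Binary.PropositionalEquality hiding ([_]; J)

private variable
  A : ℕ

slice : InfWord A → ℕ → ℕ → Word A
slice w i zero = []
slice w i (suc n) = w i ∷ slice w (suc i) n

applyUpTo≡slice : (w : InfWord A) (f : ℕ → Fin A) (i n : ℕ) →
  (∀ j → f j ≡ w (i + j)) → applyUpTo f n ≡ slice w i n
applyUpTo≡slice w f i zero f≗w = refl
applyUpTo≡slice w f i (suc n) f≗w =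
  cong₂ _∷_ (trans (f≗w 0) (cong w (+-identityʳ i)))
    (applyUpTo≡slice w (f ∘ suc) (suc i) n (λ j → trans (f≗w (suc j)) (cong w (+-suc i j))))

factor≡slice : (w : InfWord A) (i n : ℕ) → factor w i n ≡ slice w i n
factor≡slice w i n =
  trans (map-applyUpTo (λ j → j) (λ j → w (i + j)) n) (applyUpTo≡slice w _ i n (λ j → refl))

slice-++ : (w : InfWord A) (i a b : ℕ) → slice w i (a + b) ≡ slice w i a ++ slice w (i + a) b
slice-++ w i zero b = cong (λ t → slice w t b) (sym (+-identityʳ i))
slice-++ w i (suc a) b =
  cong (w i ∷_) (trans (slice-++ w (suc i) a b) (cong (λ t → slice w (suc i) a ++ slice w t b) (sym (+-suc i a))))

slice-cong : (w : InfWord A) (i i′ n : ℕ) →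
  (∀ t → t < n → w (i + t) ≡ w (i′ + t)) → slice w i n ≡ slice w i′ n
slice-cong w i i′ zero eq = refl
slice-cong w i i′ (suc n) eq =
  cong₂ _∷_ (trans (cong w (sym (+-identityʳ i))) (trans (eq 0 (s≤s z≤n)) (cong w (+-identityʳ i′))))
    (slice-cong w (suc i) (suc i′) n λ t t<n →
      trans (cong w (sym (+-suc i t))) (trans (eq (suc t) (s≤s t<n)) (cong w (+-suc i′ t))))

isPrefix-++ : (x s t : Word A) → length x ≤ length s → isPrefix x (s ++ t) ≡ isPrefix x s
isPrefix-++ [] s t _ = refl
isPrefix-++ (a ∷ x) (b ∷ s) t (s≤s |x|≤|s|) = cong (does (a Fin.≟ b) ∧_) (isPrefix-++ x s t |x|≤|s|)

indicator : Bool → ℕ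
indicator b = if b then 1 else 0

-- An occurrence of x in u ++ z ++ v lies inside u ++ z or inside z ++ v, and inside z if both.
occ-glue : (x z u v : Word A) → length x ≤ suc (length z) →
  occ x (u ++ z ++ v) + occ x z ≡ occ x (u ++ z) + occ x (z ++ v)
occ-glue x z [] v _ = +-comm (occ x (z ++ v)) (occ x z)
occ-glue x z (a ∷ u) v |x|≤1+|z| = begin
  (here (a ∷ u ++ z ++ v) + occ x (u ++ z ++ v)) + occ x z  ≡⟨ cong (λ b → (indicator b + _) + _) same-start ⟩
  (here (a ∷ u ++ z) + occ x (u ++ z ++ v)) + occ x z      ≡⟨ +-assoc (here (a ∷ u ++ z)) _ _ ⟩
  here (a ∷ u ++ z) + (occ x (u ++ z ++ v) + occ x z)      ≡⟨ cong (here (a ∷ u ++ z) +_) (occ-glue x z u v |x|≤1+|z|) ⟩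
  here (a ∷ u ++ z) + (occ x (u ++ z) + occ x (z ++ v))    ≡⟨ +-assoc (here (a ∷ u ++ z)) _ _ ⟨
  (here (a ∷ u ++ z) + occ x (u ++ z)) + occ x (z ++ v)    ∎
  where
  open ≡-Reasoning
  here : Word _ → ℕ
  here s = indicator (isPrefix x s)
  |x|≤|a∷u++z| : length x ≤ length (a ∷ u ++ z)
  |x|≤|a∷u++z| = ≤-trans |x|≤1+|z|
    (s≤s (subst (length z ≤_) (sym (length-++ u)) (m≤n+m (length z) (length u))))
  same-start : isPrefix x (a ∷ u ++ z ++ v) ≡ isPrefix x (a ∷ u ++ z)
  same-start = trans (cong (λ s → isPrefix x (a ∷ s)) (sym (++-assoc u z v)))
    (isPrefix-++ x (a ∷ u ++ z) v |x|≤|a∷u++z|)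

∼-sym : ∀ {u v : Word A} k → u ∼[ k ] v → v ∼[ k ] u
∼-sym k u∼v x 1≤|x| |x|≤k = sym (u∼v x 1≤|x| |x|≤k)

all-short? : (P : Word A → Set) → (∀ x → Dec (P x)) → ∀ k → Dec (∀ x → length x ≤ k → P x)
all-short? P P? zero = map′ (λ p → λ { [] _ → p }) (λ all → all [] z≤n) (P? [])
all-short? P P? (suc k) =
  map′ (λ { (p , ps) → λ { [] _ → p ; (a ∷ x) (s≤s |x|≤k) → ps a x |x|≤k } })
       (λ all → all [] z≤n , λ a x |x|≤k → all (a ∷ x) (s≤s |x|≤k))
       (P? [] ×-dec all? (λ a → all-short? (P ∘ (a ∷_)) (P? ∘ (a ∷_)) k))

∼-dec : (u v : Word A) (k : ℕ) → Dec (u ∼[ k ] v)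
∼-dec u v k =
  map′ (λ all x 1≤|x| |x|≤k → all x |x|≤k 1≤|x|) (λ u∼v x |x|≤k 1≤|x| → u∼v x 1≤|x| |x|≤k)
  (all-short? (λ x → 1 ≤ length x → occ x u ≡ occ x v)
              (λ x → (1 ≤? length x) →-dec (occ x u ≟ occ x v)) k)

occ-extendˡ : (x p z r r′ : Word A) → length x ≤ suc (length z) →
  occ x (z ++ r) ≡ occ x (z ++ r′) → occ x (p ++ z ++ r) ≡ occ x (p ++ z ++ r′)
occ-extendˡ x p z r r′ |x|≤1+|z| eq = +-cancelʳ-≡ (occ x z) _ _ (begin
  occ x (p ++ z ++ r) + occ x z    ≡⟨ occ-glue x z p r |x|≤1+|z| ⟩
  occ x (p ++ z) + occ x (z ++ r)  ≡⟨ cong (occ x (p ++ z) +_) eq ⟩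
  occ x (p ++ z) + occ x (z ++ r′) ≡⟨ occ-glue x z p r′ |x|≤1+|z| ⟨
  occ x (p ++ z ++ r′) + occ x z   ∎)
  where open ≡-Reasoning

occ-z⋯z⋯z : (x z s t : Word A) → length x ≤ suc (length z) →
  occ x (z ++ s ++ z ++ t ++ z) + occ x z ≡ occ x (z ++ s ++ z) + occ x (z ++ t ++ z)
occ-z⋯z⋯z x z s t |x|≤1+|z| = begin
  occ x (z ++ s ++ z ++ t ++ z) + occ x z     ≡⟨ cong (λ w → occ x w + _) (++-assoc z s (z ++ t ++ z)) ⟨
  occ x ((z ++ s) ++ z ++ t ++ z) + occ x z   ≡⟨ occ-glue x z (z ++ s) (t ++ z) |x|≤1+|z| ⟩
  occ x ((z ++ s) ++ z) + occ x (z ++ t ++ z) ≡⟨ cong (λ w → occ x w + _) (++-assoc z s z) ⟩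
  occ x (z ++ s ++ z) + occ x (z ++ t ++ z)   ∎
  where open ≡-Reasoning

-- A factor of length at most |z| + 1 cannot meet both s and t, which are separated by a copy of z.
swap-∼ : (p z s t : Word A) → (p ++ z ++ s ++ z ++ t ++ z) ∼[ suc (length z) ] (p ++ z ++ t ++ z ++ s ++ z)
swap-∼ p z s t x _ |x|≤1+|z| = occ-extendˡ x p z _ _ |x|≤1+|z| (+-cancelʳ-≡ (occ x z) _ _ (begin
  occ x (z ++ s ++ z ++ t ++ z) + occ x z       ≡⟨ occ-z⋯z⋯z x z s t |x|≤1+|z| ⟩
  occ x (z ++ s ++ z) + occ x (z ++ t ++ z)     ≡⟨ +-comm (occ x (z ++ s ++ z)) _ ⟩
  occ x (z ++ t ++ z) + occ x (z ++ s ++ z)     ≡⟨ occ-z⋯z⋯z x z t s |x|≤1+|z| ⟨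
  occ x (z ++ t ++ z ++ s ++ z) + occ x z       ∎))
  where open ≡-Reasoning

record Representatives (R : ℕ → ℕ → Set) (K : ℕ) : Set where
  field
    count    : ℕ
    rep      : Fin count → ℕ
    distinct : (a b : Fin count) → a ≢ b → ¬ R (rep a) (rep b)
    covers   : (i : ℕ) → i < K → Σ (Fin count) λ a → R i (rep a)
    count≤K  : count ≤ K

module _ (R : ℕ → ℕ → Set) (R? : ∀ i j → Dec (R i j))
         (R-refl : ∀ i → R i i) (R-sym : ∀ {i j} → R i j → R j i) where

  representatives : (K : ℕ) → Representatives R K
  representatives zero = record
    { count = 0 ; rep = λ () ; distinct = λ () ; covers = λ _ () ; count≤K = z≤n }
  representatives (suc K) with representatives K
  ... | old with any? (λ a → R? K (Representatives.rep old a))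
  ... | yes (a , K~a) = record
    { Representatives old
    ; covers  = covers′
    ; count≤K = m≤n⇒m≤1+n count≤K }
    where
    open Representatives old
    covers′ : (i : ℕ) → i < suc K → Σ (Fin count) λ b → R i (rep b)
    covers′ i i<1+K with m≤n⇒m<n∨m≡n (≤-pred i<1+K)
    ... | inj₁ i<K = covers i i<K
    ... | inj₂ refl = a , K~a
  ... | no K≁old = record
    { count    = suc count
    ; rep      = rep′
    ; distinct = distinct′
    ; covers   = covers′
    ; count≤K  = s≤s count≤K }
    where
    open Representatives old
    rep′ : Fin (suc count) → ℕ
    rep′ Fin.zero = K
    rep′ (Fin.suc a) = rep a
    distinct′ : (a b : Fin (suc count)) → a ≢ b → ¬ R (rep′ a) (rep′ b)
    distinct′ Fin.zero Fin.zero a≢b = contradiction refl a≢b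
    distinct′ Fin.zero (Fin.suc b) _ K~b = K≁old (b , K~b)
    distinct′ (Fin.suc a) Fin.zero _ a~K = K≁old (a , R-sym a~K)
    distinct′ (Fin.suc a) (Fin.suc b) a≢b = distinct a b (a≢b ∘ cong Fin.suc)
    covers′ : (i : ℕ) → i < suc K → Σ (Fin (suc count)) λ a → R i (rep′ a)
    covers′ i i<1+K with m≤n⇒m<n∨m≡n (≤-pred i<1+K)
    ... | inj₁ i<K = let (a , i~a) = covers i i<K in Fin.suc a , i~a
    ... | inj₂ refl = Fin.zero , R-refl K

classCount-≤ : (k : ℕ) (w : InfWord A) (n K : ℕ) →
  (∀ i → Σ ℕ λ i′ → i′ < K × factor w i n ≡ factor w i′ n) →
  Σ ℕ λ c → ClassCount k w n c × c ≤ K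
classCount-≤ k w n K early = count , (rep , distinct , covers′) , count≤K
  where
  _~_ : ℕ → ℕ → Set
  i ~ j = factor w i n ∼[ k ] factor w j n
  ~-sym : ∀ {i j} → i ~ j → j ~ i
  ~-sym {i} {j} = ∼-sym {u = factor w i n} {v = factor w j n} k
  open Representatives
    (representatives _~_ (λ i j → ∼-dec (factor w i n) (factor w j n) k) (λ i x _ _ → refl) ~-sym K)
  covers′ : (i : ℕ) → Σ (Fin count) λ a → i ~ rep a
  covers′ i with early i
  ... | i′ , i′<K , same with covers i′ i′<K
  ... | a , i′~a rewrite same = a , i′~a

classCount-≥ : ∀ {k n c d} {w : InfWord A} → ClassCount k w n c →
  (p : Fin d → ℕ) (x : Word A) → 1 ≤ length x → length x ≤ k →
  (∀ i j → occ x (factor w (p i) n) ≡ occ x (factor w (p j) n) → i ≡ j) → d ≤ c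
classCount-≥ {k = k} {n = n} {c = c} {d = d} {w = w} (rep , _ , covers) p x 1≤|x| |x|≤k occ-injective =
  injective⇒≤ {f = class} λ {i} {j} same → occ-injective i j
    (trans (via i x 1≤|x| |x|≤k)
      (trans (cong (λ a → occ x (factor w (rep a) n)) same) (sym (via j x 1≤|x| |x|≤k))))
  where
  class : Fin d → Fin c
  class i = proj₁ (covers (p i))
  via : ∀ i → factor w (p i) n ∼[ k ] factor w (rep (class i)) n
  via i = proj₂ (covers (p i))

isOdd : ℕ → Bool
isOdd zero = false
isOdd (suc n) = not (isOdd n)

isOdd-double : ∀ n → isOdd (n + n) ≡ false
isOdd-double zero = refl
isOdd-double (suc n) rewrite +-suc n n = trans (not-involutive (isOdd (n + n))) (isOdd-double n)

2^suc≡2^+2^ : ∀ J → 2 ^ suc J ≡ 2 ^ J + 2 ^ J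
2^suc≡2^+2^ J = cong (2 ^ J +_) (+-identityʳ (2 ^ J))

2^<2^suc : ∀ J → 2 ^ J < 2 ^ suc J
2^<2^suc J = ^-monoʳ-< 2 (s≤s (s≤s z≤n)) (n<1+n J)

n<2^n : ∀ n → n < 2 ^ n
n<2^n zero = s≤s z≤n
n<2^n (suc n) = ≤-trans (+-mono-≤ (m^n>0 2 n) (n<2^n n)) (≤-reflexive (sym (2^suc≡2^+2^ n)))

level : (n : ℕ) → Σ ℕ λ J → 2 ^ J ≤ suc n × suc n < 2 ^ suc J
level zero = 0 , s≤s z≤n , s≤s (s≤s z≤n)
level (suc n) with level n
... | J , lo , hi with suc (suc n) <? 2 ^ suc J
... | yes hi′ = J , m≤n⇒m≤1+n lo , hi′
... | no ¬hi′ = suc J , ≮⇒≥ ¬hi′ , ≤-<-trans hi (2^<2^suc (suc J))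

level-unique : ∀ {J J′ t} → 2 ^ J ≤ t → t < 2 ^ suc J → 2 ^ J′ ≤ t → t < 2 ^ suc J′ → J ≡ J′
level-unique {J} {J′} lo hi lo′ hi′ with <-cmp J J′
... | tri< J<J′ _ _ = contradiction (≤-trans (^-monoʳ-≤ 2 {suc J} {J′} J<J′) lo′) (<⇒≱ hi)
... | tri≈ _ J≡J′ _ = J≡J′
... | tri> _ _ J′<J = contradiction (≤-trans (^-monoʳ-≤ 2 {suc J′} {J} J′<J) lo) (<⇒≱ hi′)

-- τ = 0 1 1 0⁴ 1⁸ 0¹⁶ ⋯, with runs of doubling length.
τ : ℕ → Bool
τ q = isOdd (proj₁ (level q))

τ-level : ∀ J {q} → 2 ^ J ≤ suc q → suc q < 2 ^ suc J → τ q ≡ isOdd J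
τ-level J {q} lo hi with level q
... | J′ , lo′ , hi′ = cong isOdd (level-unique {J′} {J} lo′ hi′ lo hi)

switchAt : Bool → ℕ → ℕ → Bool
switchAt b zero j = not b
switchAt b (suc a) zero = b
switchAt b (suc a) (suc j) = switchAt b a j

switchAt-< : ∀ {b a j} → j < a → switchAt b a j ≡ b
switchAt-< {a = suc a} {zero} _ = refl
switchAt-< {a = suc a} {suc j} (s≤s j<a) = switchAt-< j<a

switchAt-≥ : ∀ {b a j} → a ≤ j → switchAt b a j ≡ not b
switchAt-≥ {a = zero} _ = refl
switchAt-≥ {a = suc a} {suc j} (s≤s a≤j) = switchAt-≥ a≤j

τ-switch : ∀ J q a ℓ → 2 ^ J ≤ suc q → suc q + a ≤ 2 ^ suc J → (a < ℓ → suc q + a ≡ 2 ^ suc J) →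
  ℓ ≤ 2 ^ suc J → ∀ j → j < ℓ → τ (q + j) ≡ switchAt (isOdd J) a j
τ-switch J q a ℓ lo fits crossing ℓ≤2^sucJ j j<ℓ with j <? a
... | yes j<a =
  trans (τ-level J (≤-trans lo (m≤m+n (suc q) j)) (<-≤-trans (+-monoʳ-< (suc q) j<a) fits)) (sym (switchAt-< j<a))
... | no j≮a = trans (τ-level (suc J) lo′ hi′) (sym (switchAt-≥ a≤j))
  where
  a≤j : a ≤ j
  a≤j = ≮⇒≥ j≮a
  boundary : suc q + a ≡ 2 ^ suc J
  boundary = crossing (≤-<-trans a≤j j<ℓ)
  lo′ : 2 ^ suc J ≤ suc q + j
  lo′ = subst (_≤ suc q + j) boundary (+-monoʳ-≤ (suc q) a≤j)
  hi′ : suc q + j < 2 ^ suc (suc J)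
  hi′ = <-≤-trans (+-monoʳ-< (suc q) j<ℓ)
    (≤-trans (+-mono-≤ (≤-trans (m≤m+n (suc q) a) fits) ℓ≤2^sucJ) (≤-reflexive (sym (2^suc≡2^+2^ (suc J)))))

suc[∸suc]+ : ∀ {a X} → a < X → suc (X ∸ suc a) + a ≡ X
suc[∸suc]+ {a} {X} a<X = trans (sym (+-suc (X ∸ suc a) a)) (m∸n+n≡m a<X)

τ-before-2^ : ∀ J a ℓ → a ≤ ℓ → ℓ ≤ 2 ^ J →
  ∀ j → j < ℓ → τ (2 ^ suc J ∸ suc a + j) ≡ switchAt (isOdd J) a j
τ-before-2^ J a ℓ a≤ℓ ℓ≤2^J =
  τ-switch J (2 ^ suc J ∸ suc a) a ℓ lo (≤-reflexive ends) (λ _ → ends)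
    (≤-trans ℓ≤2^J (<⇒≤ (2^<2^suc J)))
  where
  ends : suc (2 ^ suc J ∸ suc a) + a ≡ 2 ^ suc J
  ends = suc[∸suc]+ (≤-<-trans (≤-trans a≤ℓ ℓ≤2^J) (2^<2^suc J))
  lo : 2 ^ J ≤ suc (2 ^ suc J ∸ suc a)
  lo = +-cancelʳ-≤ a _ _ (begin
    2 ^ J + a                   ≤⟨ +-monoʳ-≤ (2 ^ J) (≤-trans a≤ℓ ℓ≤2^J) ⟩
    2 ^ J + 2 ^ J               ≡⟨ 2^suc≡2^+2^ J ⟨
    2 ^ suc J                   ≡⟨ ends ⟨
    suc (2 ^ suc J ∸ suc a) + a ∎)
    where open ≤-Reasoning

level-of-parity : ∀ ℓ b → Σ ℕ λ J → isOdd J ≡ b × ℓ ≤ 2 ^ J × 2 ^ suc J ≤ 8 * suc ℓ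
level-of-parity ℓ b with level ℓ
... | J , lo , hi = choose (isOdd J ≟ᵇ b)
  where
  ℓ≤2^[1+J] : ℓ ≤ 2 ^ (1 + J)
  ℓ≤2^[1+J] = ≤-trans (n≤1+n ℓ) (<⇒≤ hi)
  2^[3+J]≤ : 2 ^ (3 + J) ≤ 8 * suc ℓ
  2^[3+J]≤ = ≤-trans (≤-reflexive (^-distribˡ-+-* 2 3 J)) (*-monoʳ-≤ 8 lo)
  choose : Dec (isOdd J ≡ b) → Σ ℕ λ J′ → isOdd J′ ≡ b × ℓ ≤ 2 ^ J′ × 2 ^ suc J′ ≤ 8 * suc ℓ
  choose (yes odd≡b) =
    2 + J , trans (not-involutive (isOdd J)) odd≡b ,
    ≤-trans ℓ≤2^[1+J] (^-monoʳ-≤ 2 (n≤1+n (1 + J))) , 2^[3+J]≤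
  choose (no odd≢b) =
    1 + J , trans (cong not (¬-not odd≢b)) (not-involutive b) ,
    ℓ≤2^[1+J] , ≤-trans (^-monoʳ-≤ 2 (n≤1+n (2 + J))) 2^[3+J]≤

-- A late window of τ has at most one switch, at some offset a; it reappears before the first
-- boundary 2^(J′+1) whose level J′ has the right parity and room for the window.
τ-recurrent : ∀ ℓ q → Σ ℕ λ q′ → q′ < 8 * suc ℓ × (∀ j → j < ℓ → τ (q′ + j) ≡ τ (q + j))
τ-recurrent ℓ q with q <? 8 * suc ℓ
... | yes q<8[1+ℓ] = q , q<8[1+ℓ] , λ _ _ → refl
... | no q≮8[1+ℓ] with level q
... | J , lo , hi with level-of-parity ℓ (isOdd J)
... | J′ , same-parity , ℓ≤2^J′ , 2^[1+J′]≤ = q′ , q′<8[1+ℓ] , agree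
  where
  a : ℕ
  a = ℓ ⊓ (2 ^ suc J ∸ suc q)
  a≤ℓ : a ≤ ℓ
  a≤ℓ = m⊓n≤m ℓ _
  fits : suc q + a ≤ 2 ^ suc J
  fits = ≤-trans (+-monoʳ-≤ (suc q) (m⊓n≤n ℓ _)) (≤-reflexive (m+[n∸m]≡n (<⇒≤ hi)))
  crossing : a < ℓ → suc q + a ≡ 2 ^ suc J
  crossing a<ℓ with ⊓-sel ℓ (2 ^ suc J ∸ suc q)
  ... | inj₁ a≡ℓ = contradiction a≡ℓ (<⇒≢ a<ℓ)
  ... | inj₂ a≡rest = trans (cong (suc q +_) a≡rest) (m+[n∸m]≡n (<⇒≤ hi))
  ℓ≤2^[1+J] : ℓ ≤ 2 ^ suc J
  ℓ≤2^[1+J] = ≤-trans (≤-trans (n≤1+n ℓ) (m≤n*m (suc ℓ) 8))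
    (≤-trans (≮⇒≥ q≮8[1+ℓ]) (≤-trans (n≤1+n q) (<⇒≤ hi)))
  q′ : ℕ
  q′ = 2 ^ suc J′ ∸ suc a
  q′<8[1+ℓ] : q′ < 8 * suc ℓ
  q′<8[1+ℓ] = <-≤-trans (∸-monoʳ-< (s≤s z≤n) (≤-<-trans (≤-trans a≤ℓ ℓ≤2^J′) (2^<2^suc J′)))
    2^[1+J′]≤
  agree : ∀ j → j < ℓ → τ (q′ + j) ≡ τ (q + j)
  agree j j<ℓ = begin
    τ (q′ + j)               ≡⟨ τ-before-2^ J′ a ℓ a≤ℓ ℓ≤2^J′ j j<ℓ ⟩
    switchAt (isOdd J′) a j  ≡⟨ cong (λ b → switchAt b a j) same-parity ⟩
    switchAt (isOdd J) a j   ≡⟨ τ-switch J q a ℓ lo fits crossing ℓ≤2^[1+J] j j<ℓ ⟨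
    τ (q + j)                ∎
    where open ≡-Reasoning

trues : (ℕ → Bool) → ℕ → ℕ
trues f zero = 0
trues f (suc m) = indicator (f 0) + trues (f ∘ suc) m

trues-cong : ∀ {f g} m → (∀ j → j < m → f j ≡ g j) → trues f m ≡ trues g m
trues-cong zero _ = refl
trues-cong (suc m) f≗g =
  cong₂ _+_ (cong indicator (f≗g 0 (s≤s z≤n))) (trues-cong m λ j j<m → f≗g (suc j) (s≤s j<m))

trues-switchAt : ∀ {d m} → d ≤ m → trues (switchAt false d) m ≡ m ∸ d
trues-switchAt {zero} {m} _ = all-true m
  where
  all-true : ∀ m → trues (λ _ → true) m ≡ m
  all-true zero = refl
  all-true (suc m) = cong suc (all-true m)
trues-switchAt {suc d} {suc m} (s≤s d≤m) = trues-switchAt d≤m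

-- Here k is one less than the k of the theorem.
module Blocks (k : ℕ) where

  c₀ c₁ c₂ : Fin 3
  c₀ = Fin.zero
  c₁ = Fin.suc Fin.zero
  c₂ = Fin.suc (Fin.suc Fin.zero)

  zeros : Word 3
  zeros = replicate k c₀

  block : Bool → Word 3
  block b = c₀ ∷ zeros ++ (if b then c₁ else c₂) ∷ zeros ++ (if b then c₂ else c₁) ∷ zeros

  L : ℕ
  L = suc (k + suc (k + suc k))

  length-block : ∀ b → length (block b) ≡ L
  length-block b = cong suc (begin
    length (zeros ++ _ ∷ zeros ++ _ ∷ zeros)        ≡⟨ length-++ zeros ⟩
    length zeros + suc (length (zeros ++ _ ∷ zeros)) ≡⟨ cong (λ t → length zeros + suc t) (length-++ zeros) ⟩
    |z| + suc (|z| + suc |z|)                        ≡⟨ cong (λ t → t + suc (t + suc t)) (length-replicate k) ⟩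
    k + suc (k + suc k)                              ∎)
    where
    open ≡-Reasoning
    |z| : ℕ
    |z| = length zeros

  block-∼ : ∀ b b′ → block b ∼[ suc k ] block b′
  block-∼ true true x _ _ = refl
  block-∼ false false x _ _ = refl
  block-∼ true false = subst (λ n → block true ∼[ suc n ] block false) (length-replicate k)
    (swap-∼ [ c₀ ] zeros [ c₁ ] [ c₂ ])
  block-∼ false true = subst (λ n → block false ∼[ suc n ] block true) (length-replicate k)
    (swap-∼ [ c₀ ] zeros [ c₂ ] [ c₁ ])

  block-++ : ∀ b r →
    block b ++ r ≡ c₀ ∷ zeros ++ (if b then c₁ else c₂) ∷ zeros ++ (if b then c₂ else c₁) ∷ zeros ++ r
  block-++ b r =
    cong (c₀ ∷_) (trans (++-assoc zeros _ r) (cong (λ t → zeros ++ _ ∷ t) (++-assoc zeros _ r)))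

  -- The default letter is never read: blockWord only looks up positions below L.
  nth : Word 3 → ℕ → Fin 3
  nth [] _ = c₀
  nth (a ∷ u) zero = a
  nth (a ∷ u) (suc i) = nth u i

  drop-nth : ∀ (u : Word 3) j → j < length u → drop j u ≡ nth u j ∷ drop (suc j) u
  drop-nth (a ∷ u) zero _ = refl
  drop-nth (a ∷ u) (suc j) (s≤s j<|u|) = drop-nth u j j<|u|

  x₀ : Word 3
  x₀ = c₁ ∷ zeros ++ [ c₂ ]

  length-x₀ : length x₀ ≡ suc (suc k)
  length-x₀ = cong suc (trans (length-++ zeros) (trans (cong (_+ 1) (length-replicate k)) (+-comm k 1)))

  occ-x₀-zeros : ∀ n s → occ x₀ (replicate n c₀ ++ s) ≡ occ x₀ s
  occ-x₀-zeros zero s = refl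
  occ-x₀-zeros (suc n) s = occ-x₀-zeros n s

  isPrefix-zeros : ∀ n r → isPrefix (replicate n c₀ ++ [ c₂ ]) (replicate n c₀ ++ r) ≡ isPrefix [ c₂ ] r
  isPrefix-zeros zero r = refl
  isPrefix-zeros (suc n) r = isPrefix-zeros n r

  -- Only in block false could an occurrence straddle the boundary, ending at the first letter of r.
  occ-x₀-block : ∀ b r → isPrefix [ c₂ ] r ≡ false → occ x₀ (block b ++ r) ≡ indicator b + occ x₀ r
  occ-x₀-block true r _ = begin
    occ x₀ (block true ++ r)
      ≡⟨ cong (occ x₀) (block-++ true r) ⟩
    occ x₀ (c₀ ∷ zeros ++ c₁ ∷ zeros ++ c₂ ∷ zeros ++ r)
      ≡⟨ occ-x₀-zeros k _ ⟩
    occ x₀ (c₁ ∷ zeros ++ c₂ ∷ zeros ++ r)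
      ≡⟨ cong₂ _+_ (cong indicator (isPrefix-zeros k _)) (occ-x₀-zeros k _) ⟩
    1 + occ x₀ (c₂ ∷ zeros ++ r)
      ≡⟨ cong suc (occ-x₀-zeros k r) ⟩
    1 + occ x₀ r
      ∎
    where open ≡-Reasoning
  occ-x₀-block false r no-c₂ = begin
    occ x₀ (block false ++ r)
      ≡⟨ cong (occ x₀) (block-++ false r) ⟩
    occ x₀ (c₀ ∷ zeros ++ c₂ ∷ zeros ++ c₁ ∷ zeros ++ r)
      ≡⟨ trans (occ-x₀-zeros k _) (occ-x₀-zeros k _) ⟩
    occ x₀ (c₁ ∷ zeros ++ r)
      ≡⟨ cong₂ _+_ (cong indicator (trans (isPrefix-zeros k r) no-c₂)) (occ-x₀-zeros k r) ⟩
    occ x₀ r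
      ∎
    where open ≡-Reasoning

  module _ (σ : ℕ → Bool) where

    blockWord : InfWord 3
    blockWord i = nth (block (σ (i / L))) (i % L)

    blockWord-+* : ∀ q u → blockWord (u + q * L) ≡ nth (block (σ (u / L + q))) (u % L)
    blockWord-+* q u = cong₂ (λ a b → nth (block (σ a)) b)
      (trans (+-distrib-/-∣ʳ u (divides q refl)) (cong (u / L +_) (m*n/n≡m q L)))
      ([m+kn]%n≡m%n u q L)

    blockWord-within : ∀ q j → j < L → blockWord (j + q * L) ≡ nth (block (σ q)) j
    blockWord-within q j j<L = trans (blockWord-+* q j)
      (cong₂ (λ a b → nth (block (σ a)) b) (cong (_+ q) (m<n⇒m/n≡0 j<L)) (m<n⇒m%n≡m j<L))

    slice-within : ∀ q j r → j + r ≤ L → slice blockWord (j + q * L) r ≡ take r (drop j (block (σ q)))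
    slice-within q j zero _ = refl
    slice-within q j (suc r) j+1+r≤L = begin
      blockWord (j + q * L) ∷ slice blockWord (suc j + q * L) r
        ≡⟨ cong₂ _∷_ (blockWord-within q j j<L) (slice-within q (suc j) r (subst (_≤ L) (+-suc j r) j+1+r≤L)) ⟩
      take (suc r) (nth (block (σ q)) j ∷ drop (suc j) (block (σ q)))
        ≡⟨ cong (take (suc r)) (drop-nth (block (σ q)) j (subst (j <_) (sym (length-block (σ q))) j<L)) ⟨
      take (suc r) (drop j (block (σ q)))
        ∎
      where
      open ≡-Reasoning
      j<L : j < L
      j<L = <-≤-trans (m<m+n j (s≤s z≤n)) j+1+r≤L

    slice-block : ∀ q → slice blockWord (q * L) L ≡ block (σ q)
    slice-block q = trans (slice-within q 0 L ≤-refl) (take-all L (block (σ q)) (≤-reflexive (length-block (σ q))))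

    blockWord-periodic : KAbelianPeriodic (suc k) blockWord
    blockWord-periodic = (λ i → i * L) , refl , (λ i → m<n+m (i * L) (s≤s z≤n)) , λ i j →
      subst₂ (λ u v → u ∼[ suc k ] v) (sym (factor≡block i)) (sym (factor≡block j)) (block-∼ (σ i) (σ j))
      where
      factor≡block : ∀ i → factor blockWord (i * L) (suc i * L ∸ i * L) ≡ block (σ i)
      factor≡block i = trans (factor≡slice blockWord (i * L) _)
        (trans (cong (slice blockWord (i * L)) (m+n∸n≡m L (i * L))) (slice-block i))

    slice-shift : ∀ {ℓ} q q′ r n → (∀ j → j < ℓ → σ (q + j) ≡ σ (q′ + j)) → r + n ≤ ℓ * L →
      slice blockWord (r + q * L) n ≡ slice blockWord (r + q′ * L) n
    slice-shift q q′ r n agree r+n≤ℓL = slice-cong blockWord _ _ n λ t t<n → begin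
      blockWord ((r + q * L) + t)
        ≡⟨ cong blockWord (xy∙z≈xz∙y r (q * L) t) ⟩
      blockWord ((r + t) + q * L)
        ≡⟨ blockWord-+* q (r + t) ⟩
      nth (block (σ ((r + t) / L + q))) ((r + t) % L)
        ≡⟨ cong (λ b → nth (block b) ((r + t) % L)) (same-block t t<n) ⟩
      nth (block (σ ((r + t) / L + q′))) ((r + t) % L)
        ≡⟨ blockWord-+* q′ (r + t) ⟨
      blockWord ((r + t) + q′ * L)
        ≡⟨ cong blockWord (xy∙z≈xz∙y r (q′ * L) t) ⟨
      blockWord ((r + q′ * L) + t)
        ∎
      where
      open ≡-Reasoning
      same-block : ∀ t → t < n → σ ((r + t) / L + q) ≡ σ ((r + t) / L + q′)
      same-block t t<n = trans (cong σ (+-comm _ q))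
        (trans (agree _ (m<n*o⇒m/o<n (<-≤-trans (+-monoʳ-< r t<n) r+n≤ℓL))) (cong σ (+-comm q′ _)))

    slice-no-c₂ : ∀ q n → isPrefix [ c₂ ] (slice blockWord (q * L) n) ≡ false
    slice-no-c₂ q zero = refl
    slice-no-c₂ q (suc n) =
      cong (λ a → isPrefix [ c₂ ] (a ∷ slice blockWord (suc (q * L)) n)) (blockWord-within q 0 (s≤s z≤n))

    occ-x₀-slice : ∀ m r q → occ x₀ (slice blockWord (q * L) (m * L + r)) ≡
      trues (λ j → σ (q + j)) m + occ x₀ (slice blockWord ((q + m) * L) r)
    occ-x₀-slice zero r q = cong (λ t → occ x₀ (slice blockWord (t * L) r)) (sym (+-identityʳ q))
    occ-x₀-slice (suc m) r q = begin
      occ x₀ (slice blockWord (q * L) ((L + m * L) + r))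
        ≡⟨ cong (λ t → occ x₀ (slice blockWord (q * L) t)) (+-assoc L (m * L) r) ⟩
      occ x₀ (slice blockWord (q * L) (L + (m * L + r)))
        ≡⟨ cong (occ x₀) (slice-++ blockWord (q * L) L (m * L + r)) ⟩
      occ x₀ (slice blockWord (q * L) L ++ slice blockWord (q * L + L) (m * L + r))
        ≡⟨ cong₂ (λ u i → occ x₀ (u ++ slice blockWord i (m * L + r))) (slice-block q) (+-comm (q * L) L) ⟩
      occ x₀ (block (σ q) ++ slice blockWord (suc q * L) (m * L + r))
        ≡⟨ occ-x₀-block (σ q) _ (slice-no-c₂ (suc q) (m * L + r)) ⟩
      indicator (σ q) + occ x₀ (slice blockWord (suc q * L) (m * L + r))
        ≡⟨ cong (indicator (σ q) +_) (occ-x₀-slice m r (suc q)) ⟩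
      indicator (σ q) + (trues (λ j → σ (suc q + j)) m + occ x₀ (slice blockWord ((suc q + m) * L) r))
        ≡⟨ cong (λ n → indicator (σ q) + (n + occ x₀ (slice blockWord ((suc q + m) * L) r)))
                (trues-cong m λ j _ → cong σ (sym (+-suc q j))) ⟩
      indicator (σ q) + (trues (λ j → σ (q + suc j)) m + occ x₀ (slice blockWord ((suc q + m) * L) r))
        ≡⟨ cong₂ (λ t i → indicator (σ t) + (trues (λ j → σ (q + suc j)) m + occ x₀ (slice blockWord (i * L) r)))
                 (sym (+-identityʳ q)) (sym (+-suc q m)) ⟩
      indicator (σ (q + 0)) + (trues (λ j → σ (q + suc j)) m + occ x₀ (slice blockWord ((q + suc m) * L) r))
        ≡⟨ +-assoc (indicator (σ (q + 0))) _ _ ⟨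
      trues (λ j → σ (q + j)) (suc m) + occ x₀ (slice blockWord ((q + suc m) * L) r)
        ∎
      where open ≡-Reasoning

  n<[1+n/L]*L : ∀ n → n < suc (n / L) * L
  n<[1+n/L]*L n = subst (_< suc (n / L) * L) (sym (m≡m%n+[m/n]*n n L)) (+-monoˡ-< (n / L * L) (m%n<n n L))

  late : ℕ → ℕ → ℕ
  late m d = 2 ^ suc (m + m) ∸ suc d

  -- Just before 2^(2m+1), τ reads false^d true^(m+1−d), so these windows hold m − d blocks of type true.
  occ-x₀-late : ∀ m r d → r ≤ L → d ≤ m →
    occ x₀ (slice (blockWord τ) (late m d * L) (m * L + r)) ≡ (m ∸ d) + occ x₀ (take r (block true))
  occ-x₀-late m r d r≤L d≤m = begin
    occ x₀ (slice (blockWord τ) (late m d * L) (m * L + r))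
      ≡⟨ occ-x₀-slice τ m r (late m d) ⟩
    trues (λ j → τ (late m d + j)) m + occ x₀ (slice (blockWord τ) ((late m d + m) * L) r)
      ≡⟨ cong₂ _+_ (trues-cong m λ j j<m → window j (m≤n⇒m≤1+n j<m)) (cong (occ x₀) partial) ⟩
    trues (switchAt false d) m + occ x₀ (take r (block true))
      ≡⟨ cong (_+ _) (trues-switchAt d≤m) ⟩
    (m ∸ d) + occ x₀ (take r (block true))
      ∎
    where
    open ≡-Reasoning
    window : ∀ j → j < suc m → τ (late m d + j) ≡ switchAt false d j
    window j j<1+m =
      trans (τ-before-2^ (m + m) d (suc m) (m≤n⇒m≤1+n d≤m) 1+m≤2^[m+m] j j<1+m)
            (cong (λ b → switchAt b d j) (isOdd-double m))
      where
      1+m≤2^[m+m] : suc m ≤ 2 ^ (m + m)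
      1+m≤2^[m+m] = ≤-trans (n<2^n m) (^-monoʳ-≤ 2 (m≤m+n m m))
    partial : slice (blockWord τ) ((late m d + m) * L) r ≡ take r (block true)
    partial = trans (slice-within τ (late m d + m) 0 r r≤L)
      (cong (λ b → take r (block b)) (trans (window m ≤-refl) (switchAt-≥ d≤m)))

  n≤L*classes : ∀ n c → ClassCount (suc (suc k)) (blockWord τ) n c → n ≤ L * c
  n≤L*classes n c classes =
    ≤-trans (<⇒≤ (n<[1+n/L]*L n)) (≤-trans (*-monoˡ-≤ L 1+m≤c) (≤-reflexive (*-comm c L)))
    where
    m : ℕ
    m = n / L
    n≡mL+r : n ≡ m * L + n % L
    n≡mL+r = trans (m≡m%n+[m/n]*n n L) (+-comm (n % L) (m * L))
    occ-window : ∀ (d : Fin (suc m)) →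
      occ x₀ (factor (blockWord τ) (late m (toℕ d) * L) n) ≡ (m ∸ toℕ d) + occ x₀ (take (n % L) (block true))
    occ-window d = trans
      (cong (occ x₀) (trans (factor≡slice _ _ n) (cong (slice (blockWord τ) _) n≡mL+r)))
      (occ-x₀-late m (n % L) (toℕ d) (<⇒≤ (m%n<n n L)) (toℕ≤pred[n] d))
    1+m≤c : suc m ≤ c
    1+m≤c = classCount-≥ {n = n} {w = blockWord τ} classes (λ d → late m (toℕ d) * L) x₀
      (s≤s z≤n) (≤-reflexive length-x₀)
      λ d d′ same → toℕ-injective (∸-cancelˡ-≡ (toℕ≤pred[n] d) (toℕ≤pred[n] d′)
        (+-cancelʳ-≡ _ _ _ (trans (sym (occ-window d)) (trans same (occ-window d′)))))

  early-copy : ∀ n i →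
    Σ ℕ λ i′ → i′ < 8 * (3 + n / L) * L × factor (blockWord τ) i n ≡ factor (blockWord τ) i′ n
  early-copy n i with τ-recurrent (2 + n / L) (i / L)
  ... | q′ , q′<8[3+m] , agree = i % L + q′ * L , i′< , same-factor
    where
    i′< : i % L + q′ * L < 8 * (3 + n / L) * L
    i′< = <-≤-trans (+-monoˡ-< (q′ * L) (m%n<n i L)) (*-monoˡ-≤ L q′<8[3+m])
    r+n≤ : i % L + n ≤ (2 + n / L) * L
    r+n≤ = <⇒≤ (+-mono-< (m%n<n i L) (n<[1+n/L]*L n))
    same-factor : factor (blockWord τ) i n ≡ factor (blockWord τ) (i % L + q′ * L) n
    same-factor = begin
      factor (blockWord τ) i n                    ≡⟨ factor≡slice _ i n ⟩
      slice (blockWord τ) i n                     ≡⟨ cong (λ t → slice (blockWord τ) t n) (m≡m%n+[m/n]*n i L) ⟩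
      slice (blockWord τ) (i % L + i / L * L) n   ≡⟨ slice-shift τ (i / L) q′ (i % L) n (λ j → sym ∘ agree j) r+n≤ ⟩
      slice (blockWord τ) (i % L + q′ * L) n      ≡⟨ factor≡slice _ _ n ⟨
      factor (blockWord τ) (i % L + q′ * L) n     ∎
      where open ≡-Reasoning

  complexity-linear : ThetaLinear (suc (suc k)) (blockWord τ)
  complexity-linear = L , 9 , 24 * L , λ n 24L≤n →
    let (c , classes , c≤) = classCount-≤ _ (blockWord τ) n _ (early-copy n)
    in c , classes , n≤L*classes n c classes , ≤-trans c≤ (bound n 24L≤n)
    where
    bound : ∀ n → 24 * L ≤ n → 8 * (3 + n / L) * L ≤ 9 * n
    bound n 24L≤n = begin
      8 * (3 + n / L) * L       ≡⟨ expand (n / L) L ⟩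
      24 * L + 8 * (n / L * L)  ≤⟨ +-mono-≤ 24L≤n (*-monoʳ-≤ 8 (m/n*n≤m n L)) ⟩
      n + 8 * n                 ∎
      where
      open ≤-Reasoning
      expand : ∀ m L → 8 * (3 + m) * L ≡ 24 * L + 8 * (m * L)
      expand = solve-∀

lemma3 : (k : ℕ) → 1 ≤ k →
    Σ ℕ λ m → Σ (InfWord m) λ w →
    KAbelianPeriodic k w × ThetaLinear (suc k) w
lemma3 (suc k) _ = 3 , blockWord k τ , blockWord-periodic k τ , complexity-linear k
  where open Blocks
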